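{- Let $n\ge1$, $1\le k\le n$. The set $M=\{(w,u(w))\}$ of pairs defined below is a partial matching on the Hasse diagram of $\Pi(n,k)$ which is acyclic: there is no sequence of distinct elements $a_1,\dots,a_r$, $r\ge2$, with $a_1\lessdot u(a_1)\gtrdot a_2\lessdot u(a_2)\gtrdot\cdots\gtrdot a_r\lessdot u(a_r)\gtrdot a_1$.
   Context: $\mathcal R(n,k)$ is the set of RG-words $w=w_1\cdots w_n$ (positive integers, $w_1=1$, $w_i\le\max(w_1,\dots,w_{i-1})+1$, $\max_iw_i=k$). $\Pi(n,k)$ is the poset on $\mathcal R(n,k)$ generated by covers $v\lessdot w$ when $w$ arises from $v$ by increasing exactly one entry by $1$. The matching: for $w\in\mathcal R(n,k)$ let $i\ge2$ be the smallest index such that $w_1\le w_2\le\dots\le w_{i-1}$ and either $w_{i-1}>w_i$, or $w_{i-1}=w_i$ with both even. If $w_i$ is odd, $w$ is matched with $u(w)=w_1\cdots w_{i-1}(w_i+1)w_{i+1}\cdots w_n$ (a cover of $w$); if $w_i$ is even, $w$ is matched with $d(w)=w_1\cdots w_{i-1}(w_i-1)w_{i+1}\cdots w_n$ (covered by $w$), i.e. $u(d(w))=w$. If no such $i$ exists, $w$ is unmatched. -}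

module Defs where

open import Data.Nat using (ℕ; zero; suc; _≤_; _<_; _⊔_; _%_; _≡ᵇ_; _<ᵇ_)
open import Data.Bool using (Bool; true; false; _∧_; _∨_; if_then_else_)
open import Data.List using (List; []; _∷_; length; foldr)
open import Data.Maybe using (Maybe; just; nothing)
open import Data.Product using (_×_; _,_; ∃; ∃-syntax)
open import Data.Sum using (_⊎_)
open import Data.Unit using (⊤)
open import Data.Empty using (⊥)
open import Data.Fin using (Fin; zero; suc; inject₁; fromℕ)
open import Relation.Binary.PropositionalEquality using (_≡_)

Word : Set
Word = List ℕ

-- restricted growth of the tail, given the maximum m of the prefix so far
rgFrom : ℕ → Word → Set
rgFrom m [] = ⊤
rgFrom m (x ∷ xs) = (1 ≤ x) × (x ≤ suc m) × rgFrom (m ⊔ x) xs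

IsRG : Word → Set
IsRG [] = ⊥
IsRG (x ∷ xs) = (x ≡ 1) × rgFrom 1 xs

maxW : Word → ℕ
maxW = foldr _⊔_ 0

InR : ℕ → ℕ → Word → Set
InR n k w = (length w ≡ n) × IsRG w × (maxW w ≡ k)

incAt : ℕ → Word → Word
incAt i [] = []
incAt zero (x ∷ xs) = suc x ∷ xs
incAt (suc i) (x ∷ xs) = x ∷ incAt i xs

Cover : ℕ → ℕ → Word → Word → Set
Cover n k v w = InR n k v × InR n k w × ∃[ i ] ((i < length v) × (w ≡ incAt i v))

evenᵇ : ℕ → Bool
evenᵇ x = (x % 2) ≡ᵇ 0

-- Since we stop at the first
-- strict descent, the prefix before it is automatically weakly increasing.
scan : ℕ → Word → ℕ → Maybe (ℕ × ℕ)
scan p [] j = nothing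
scan p (x ∷ xs) j =
  if (x <ᵇ p) ∨ ((p ≡ᵇ x) ∧ evenᵇ x) then just (j , x) else scan x xs (suc j)

matchPos : Word → Maybe (ℕ × ℕ)
matchPos [] = nothing
matchPos (x ∷ xs) = scan x xs 1

InM : ℕ → ℕ → Word → Word → Set
InM n k v w = InR n k v × ∃[ i ] ∃[ x ]
  ((matchPos v ≡ just (i , x)) × (evenᵇ x ≡ false) × (w ≡ incAt i v))

IsPartialMatching : ℕ → ℕ → Set
IsPartialMatching n k =
  (∀ v w → InM n k v w → Cover n k v w) ×
  (∀ a b c d → InM n k a b → InM n k c d →
     (a ≡ c ⊎ a ≡ d ⊎ b ≡ c ⊎ b ≡ d) → (a ≡ c × b ≡ d))

-- no cycle a₁ ⋖ u(a₁) ⋗ a₂ ⋖ u(a₂) ⋗ ⋯ ⋗ a_r ⋖ u(a_r) ⋗ a₁ with r = m+2 ≥ 2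
-- distinct aⱼ, where bⱼ is the partner u(aⱼ) with (aⱼ , bⱼ) ∈ M
IsAcyclic : ℕ → ℕ → Set
IsAcyclic n k = ∀ m (a b : Fin (suc (suc m)) → Word) →
  (∀ i j → a i ≡ a j → i ≡ j) →
  (∀ i → InM n k (a i) (b i)) →
  (∀ (i : Fin (suc m)) → Cover n k (a (suc i)) (b (inject₁ i))) →
  Cover n k (a zero) (b (fromℕ (suc m))) →
  ⊥

module Submission where

-- Its outcome is described by an inductive
-- relation 'Stop' (the scan stops r steps in, at value x), proved equivalent
-- to 'scan', so that every property of the rule is a structural induction:
--   * raising the stopping entry (which is odd, hence a strict descent) keeps
--     the word an RG-word with the same maximum, and the rule then applies at
--     the same place to the even value x+1;
--   * raising an entry after the stopping position does not move the rule.
-- These give that (w , u w) is a cover (Stop-rgFrom, Stop-maxW), and that M is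
-- a matching: the rule position is a function of the word and parities of
-- matched entries cannot clash (M-matching).
-- For acyclicity, if c ⋖ u(a) with c ≠ a and c itself matched upward, then c
-- is lexicographically smaller than a (M-descent): raising c at an earlier
-- position is the lexicographic descent, the same position forces c = a, and
-- a later position would make the rule of c apply to the even value x+1.
-- A cycle of M would thus close a descending chain of the strict
-- lexicographic order (descending-chain), contradicting irreflexivity.

open import Defs
open import Data.Nat using (ℕ; _≤_)
open import Data.Product using (_×_)

open import Data.Nat using (zero; suc; _<_; _+_; _⊔_; _<ᵇ_; _≡ᵇ_; z≤n; s≤s; z<s; s<s)
open import Data.Nat.Properties
open import Data.Bool using (Bool; true; false; _∨_; _∧_; T)
open import Data.Bool.Properties using (T-≡; ∨-zeroʳ)
open import Data.List using ([]; _∷_; length)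
open import Data.List.Properties using (∷-injectiveˡ; ∷-injectiveʳ)
open import Data.List.Relation.Binary.Lex.Strict as Lex
  using (Lex-<; this; next)
open import Data.List.Relation.Binary.Pointwise as Pointwise using ()
open import Data.Maybe using (just)
open import Data.Maybe.Properties using (just-injective)
open import Data.Product using (_,_; proj₁; proj₂; ∃-syntax)
open import Data.Sum using (_⊎_; inj₁; inj₂)
open import Data.Fin using (Fin; zero; suc; inject₁; fromℕ; toℕ)
open import Data.Fin.Properties using (toℕ-inject₁) renaming (0≢1+n to zero≢suc)
open import Function using (_∘_; Equivalence)
open import Relation.Binary.Definitions using (Transitive; tri<; tri≈; tri>)
open import Relation.Binary.Structures using (IsStrictPartialOrder)
open import Relation.Binary.PropositionalEquality
open import Relation.Nullary using (¬_)

Odd : ℕ → Set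
Odd x = evenᵇ x ≡ false

Odd⇒suc-even : ∀ {x} → Odd x → evenᵇ (suc x) ≡ true
Odd⇒suc-even {zero} ()
Odd⇒suc-even {suc zero} _ = refl
Odd⇒suc-even {suc (suc x)} odd = Odd⇒suc-even {x} odd

odd-clash : ∀ {x y} → Odd x → Odd y → x ≢ suc y
odd-clash {y = y} ox oy refl with () ← trans (sym (Odd⇒suc-even {y} oy)) ox

stopsᵇ : ℕ → ℕ → Bool
stopsᵇ q y = (y <ᵇ q) ∨ ((q ≡ᵇ y) ∧ evenᵇ y)

stops-odd⇒< : ∀ q y → stopsᵇ q y ≡ true → Odd y → y < q
stops-odd⇒< q y stop odd with y <ᵇ q in y<ᵇq | q ≡ᵇ y
... | true  | _     = <ᵇ⇒< y q (Equivalence.from T-≡ y<ᵇq)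
... | false | true  with () ← trans (sym stop) odd
... | false | false with () ← stop

¬stops⇒≤ : ∀ q y → stopsᵇ q y ≡ false → q ≤ y
¬stops⇒≤ q y stop with y <ᵇ q in y<ᵇq
... | false = ≮⇒≥ (λ y<q → subst T y<ᵇq (<⇒<ᵇ y<q))
... | true  with () ← stop

-- after raising an odd strict descent y < q, the rule still applies there:
-- either y+1 < q, or y+1 = q is a repeated even value
<⇒stops-suc : ∀ q y → y < q → Odd y → stopsᵇ q (suc y) ≡ true
<⇒stops-suc q y y<q odd with m≤n⇒m<n∨m≡n y<q
... | inj₁ y+1<q rewrite Equivalence.to T-≡ (<⇒<ᵇ y+1<q) = refl
... | inj₂ refl
  rewrite Equivalence.to T-≡ (≡⇒≡ᵇ (suc y) (suc y) refl) | Odd⇒suc-even {y} odd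
  = ∨-zeroʳ (suc y <ᵇ suc y)

-- Stop q w r x: scanning w, preceded by the entry q, stops after r steps at
-- an entry of value x.
data Stop : ℕ → Word → ℕ → ℕ → Set where
  here  : ∀ {q y ys} → stopsᵇ q y ≡ true → Stop q (y ∷ ys) 0 y
  there : ∀ {q y ys r x} → stopsᵇ q y ≡ false → Stop y ys r x →
          Stop q (y ∷ ys) (suc r) x

scan-sound : ∀ q w j {i x} → scan q w j ≡ just (i , x) →
  ∃[ r ] (Stop q w r x × i ≡ j + r)
scan-sound q (y ∷ ys) j eq with stopsᵇ q y in stop
... | true with refl ← eq = 0 , here stop , sym (+-identityʳ j)
... | false with scan-sound y ys (suc j) eq
...   | r , s , refl = suc r , there stop s , sym (+-suc j r)

scan-complete : ∀ {q w r x} j → Stop q w r x → scan q w j ≡ just (j + r , x)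
scan-complete j (here {q} {y} stop) rewrite stop | +-identityʳ j = refl
scan-complete j (there {q} {y} {r = r} stop s)
  rewrite stop | +-suc j r = scan-complete (suc j) s

Stop-bound : ∀ {q w r x} → Stop q w r x → r < length w
Stop-bound (here _)    = z<s
Stop-bound (there _ s) = s<s (Stop-bound s)

Stop-inc : ∀ {q w r x} → Stop q w r x → Odd x → Stop q (incAt r w) r (suc x)
Stop-inc (here {q} {y} stop) odd = here (<⇒stops-suc q y (stops-odd⇒< q y stop odd) odd)
Stop-inc (there stop s) odd = there stop (Stop-inc s odd)

Stop-prefix : ∀ {q w p r x} → Stop q (incAt p w) r x → r < p → Stop q w r x
Stop-prefix {w = []} ()
Stop-prefix {w = y ∷ ys} {suc p} (here stop) _ = here stop
Stop-prefix {w = y ∷ ys} {suc p} (there stop s) (s<s r<p) = there stop (Stop-prefix s r<p)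

Stop-rgFrom : ∀ {q w r x} → Stop q w r x → Odd x → rgFrom q w → rgFrom q (incAt r w)
Stop-rgFrom (here {q} {y} {ys} stop) odd (_ , _ , rest) =
  s≤s z≤n , m≤n⇒m≤1+n y<q , subst (λ m → rgFrom m ys) (trans q⊔y≡q (sym q⊔y+1≡q)) rest
  where
  y<q : y < q
  y<q = stops-odd⇒< q y stop odd
  q⊔y≡q : q ⊔ y ≡ q
  q⊔y≡q = m≥n⇒m⊔n≡m (<⇒≤ y<q)
  q⊔y+1≡q : q ⊔ suc y ≡ q
  q⊔y+1≡q = m≥n⇒m⊔n≡m y<q
Stop-rgFrom (there {q} {y} {ys} {r} stop s) odd (1≤y , y≤q+1 , rest) =
  1≤y , y≤q+1 ,
  subst (λ m → rgFrom m (incAt r ys)) (sym q⊔y≡y)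
    (Stop-rgFrom s odd (subst (λ m → rgFrom m ys) q⊔y≡y rest))
  where
  q⊔y≡y : q ⊔ y ≡ y
  q⊔y≡y = m≤n⇒m⊔n≡n (¬stops⇒≤ q y stop)

⊔-absorb-below : ∀ {a q} m → a ≤ q → q ⊔ (a ⊔ m) ≡ q ⊔ m
⊔-absorb-below {a} {q} m a≤q =
  trans (sym (⊔-assoc q a m)) (cong (_⊔ m) (m≥n⇒m⊔n≡m a≤q))

⊔-absorb-above : ∀ {q y} m → q ≤ y → q ⊔ (y ⊔ m) ≡ y ⊔ m
⊔-absorb-above {q} {y} m q≤y =
  trans (sym (⊔-assoc q y m)) (cong (_⊔ m) (m≤n⇒m⊔n≡n q≤y))

Stop-maxW : ∀ {q w r x} → Stop q w r x → Odd x → maxW (q ∷ incAt r w) ≡ maxW (q ∷ w)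
Stop-maxW (here {q} {y} {ys} stop) odd =
  trans (⊔-absorb-below (maxW ys) y<q) (sym (⊔-absorb-below (maxW ys) (<⇒≤ y<q)))
  where
  y<q : y < q
  y<q = stops-odd⇒< q y stop odd
Stop-maxW (there {q} {y} {ys} {r} stop s) odd = begin
  q ⊔ (y ⊔ maxW (incAt r ys)) ≡⟨ ⊔-absorb-above _ q≤y ⟩
  y ⊔ maxW (incAt r ys)       ≡⟨ Stop-maxW s odd ⟩
  y ⊔ maxW ys                 ≡⟨ ⊔-absorb-above _ q≤y ⟨
  q ⊔ (y ⊔ maxW ys)           ∎
  where
  open ≡-Reasoning
  q≤y : q ≤ y
  q≤y = ¬stops⇒≤ q y stop

data RuleAt : Word → ℕ → ℕ → Set where
  rule : ∀ {v vs r x} → Stop v vs r x → RuleAt (v ∷ vs) (suc r) x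

matchPos-sound : ∀ w {i x} → matchPos w ≡ just (i , x) → RuleAt w i x
matchPos-sound (v ∷ vs) mp with scan-sound v vs 1 mp
... | r , s , refl = rule s

matchPos-complete : ∀ {w i x} → RuleAt w i x → matchPos w ≡ just (i , x)
matchPos-complete (rule s) = scan-complete 1 s

matchPos-unique : ∀ w {i x j y} → matchPos w ≡ just (i , x) → matchPos w ≡ just (j , y) →
  (i , x) ≡ (j , y)
matchPos-unique _ e e′ = just-injective (trans (sym e) e′)

matchPos-bound : ∀ w {i x} → matchPos w ≡ just (i , x) → i < length w
matchPos-bound w mp with matchPos-sound w mp
... | rule s = s<s (Stop-bound s)

matchPos-u : ∀ w {i x} → matchPos w ≡ just (i , x) → Odd x →
  matchPos (incAt i w) ≡ just (i , suc x)
matchPos-u w mp odd with matchPos-sound w mp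
... | rule s = matchPos-complete (rule (Stop-inc s odd))

matchPos-prefix : ∀ w {p i x} → matchPos (incAt p w) ≡ just (i , x) → i < p →
  matchPos w ≡ just (i , x)
matchPos-prefix (v ∷ vs) {suc p} mp i<p with matchPos-sound (v ∷ incAt p vs) mp
... | rule s = matchPos-complete (rule (Stop-prefix s (≤-pred i<p)))

u-preserves-RG : ∀ w {i x} → matchPos w ≡ just (i , x) → Odd x → IsRG w → IsRG (incAt i w)
u-preserves-RG w mp odd rg with matchPos-sound w mp | rg
... | rule s | refl , rest = refl , Stop-rgFrom s odd rest

u-preserves-max : ∀ w {i x} → matchPos w ≡ just (i , x) → Odd x → maxW (incAt i w) ≡ maxW w
u-preserves-max w mp odd with matchPos-sound w mp
... | rule s = Stop-maxW s odd

incAt-length : ∀ i w → length (incAt i w) ≡ length w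
incAt-length i [] = refl
incAt-length zero (x ∷ w) = refl
incAt-length (suc i) (x ∷ w) = cong suc (incAt-length i w)

incAt-injective : ∀ i {v w} → incAt i v ≡ incAt i w → v ≡ w
incAt-injective i {[]} {[]} _ = refl
incAt-injective zero {[]} {_ ∷ _} ()
incAt-injective (suc i) {[]} {_ ∷ _} ()
incAt-injective zero {_ ∷ _} {[]} ()
incAt-injective (suc i) {_ ∷ _} {[]} ()
incAt-injective zero {x ∷ v} {y ∷ w} e =
  cong₂ _∷_ (suc-injective (∷-injectiveˡ e)) (∷-injectiveʳ e)
incAt-injective (suc i) {x ∷ v} {y ∷ w} e =
  cong₂ _∷_ (∷-injectiveˡ e) (incAt-injective i (∷-injectiveʳ e))

M⊆Cover : ∀ {n k} v w → InM n k v w → Cover n k v w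
M⊆Cover v _ (inR@(len , rg , mx) , i , _ , mp , odd , refl) =
  inR ,
  (trans (incAt-length i v) len , u-preserves-RG v mp odd rg ,
   trans (u-preserves-max v mp odd) mx) ,
  i , matchPos-bound v mp , refl

M-matching : ∀ {n k} a b c d → InM n k a b → InM n k c d →
  (a ≡ c ⊎ a ≡ d ⊎ b ≡ c ⊎ b ≡ d) → (a ≡ c × b ≡ d)
M-matching a _ c _ (_ , i , x , ma , oa , refl) (_ , j , y , mc , oc , refl) = shared
  where
  ua : matchPos (incAt i a) ≡ just (i , suc x)
  ua = matchPos-u a ma oa
  uc : matchPos (incAt j c) ≡ just (j , suc y)
  uc = matchPos-u c mc oc
  shared : (a ≡ c ⊎ a ≡ incAt j c ⊎ incAt i a ≡ c ⊎ incAt i a ≡ incAt j c) →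
    (a ≡ c × incAt i a ≡ incAt j c)
  shared (inj₁ refl) with refl ← matchPos-unique a ma mc = refl , refl
  shared (inj₂ (inj₁ refl)) with () ← odd-clash oa oc (cong proj₂ (matchPos-unique a ma uc))
  shared (inj₂ (inj₂ (inj₁ refl))) with () ← odd-clash oc oa (cong proj₂ (matchPos-unique c mc ua))
  shared (inj₂ (inj₂ (inj₂ e)))
    with refl ← cong proj₁ (matchPos-unique (incAt i a) ua (trans (cong matchPos e) uc))
    = incAt-injective i e , e

_<ₗ_ : Word → Word → Set
_<ₗ_ = Lex-< _≡_ _<_

<ₗ-trans : Transitive _<ₗ_
<ₗ-trans = IsStrictPartialOrder.trans (Lex.<-isStrictPartialOrder <-isStrictPartialOrder)

<ₗ-irrefl : ∀ w → ¬ (w <ₗ w)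
<ₗ-irrefl w = Lex.<-irreflexive <-irrefl (Pointwise.refl refl)

incAt-lex : ∀ {p i c a} → p < i → p < length c → incAt p c ≡ incAt i a → c <ₗ a
incAt-lex {zero} {suc i} {x ∷ c} {y ∷ a} _ _ e = this (≤-reflexive (∷-injectiveˡ e))
incAt-lex {suc p} {suc i} {x ∷ c} {y ∷ a} (s<s p<i) (s<s p<len) e =
  next (∷-injectiveˡ e) (incAt-lex p<i p<len (∷-injectiveʳ e))

M-descent : ∀ {n k a b c d} → InM n k a b → InM n k c d → Cover n k c b → c ≢ a → c <ₗ a
M-descent {a = a} {c = c} (_ , i , _ , ma , oa , refl) (_ , _ , _ , mc , oc , _)
          (_ , _ , p , p<len , b≡) c≢a
  with <-cmp p i
... | tri< p<i _ _ = incAt-lex p<i p<len (sym b≡)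
... | tri≈ _ refl _ with () ← c≢a (incAt-injective p (sym b≡))
... | tri> _ _ i<p
  with () ← odd-clash oc oa (cong proj₂ (matchPos-unique c mc
              (matchPos-prefix c (trans (cong matchPos (sym b≡)) (matchPos-u a ma oa)) i<p)))

descending-chain : ∀ {A : Set} (_≺_ : A → A → Set) → Transitive _≺_ →
  ∀ m (a : Fin (suc (suc m)) → A) → (∀ i → a (suc i) ≺ a (inject₁ i)) →
  a (fromℕ (suc m)) ≺ a zero
descending-chain _≺_ trans′ zero a step = step zero
descending-chain _≺_ trans′ (suc m) a step =
  trans′ (step (fromℕ (suc m)))
         (descending-chain _≺_ trans′ m (a ∘ inject₁) (step ∘ inject₁))

suc≢inject₁ : ∀ {m} (i : Fin m) → suc i ≢ inject₁ i
suc≢inject₁ i e = 1+n≢n (trans (cong toℕ e) (toℕ-inject₁ i))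

theorem4p3 : (n k : ℕ) → 1 ≤ n → 1 ≤ k → k ≤ n →
    IsPartialMatching n k × IsAcyclic n k
theorem4p3 n k _ _ _ = (M⊆Cover , M-matching) , acyclic
  where
  acyclic : IsAcyclic n k
  acyclic m a _ distinct inM cover closing = <ₗ-irrefl (a zero) (<ₗ-trans first<last last<first)
    where
    last<first : a (fromℕ (suc m)) <ₗ a zero
    last<first = descending-chain _<ₗ_ <ₗ-trans m a λ i →
      M-descent (inM (inject₁ i)) (inM (suc i)) (cover i) (suc≢inject₁ i ∘ distinct _ _)
    first<last : a zero <ₗ a (fromℕ (suc m))
    first<last = M-descent (inM (fromℕ (suc m))) (inM zero) closing (zero≢suc ∘ distinct _ _)
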